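{- Let $S$ be a signature and $t$ an $S$-term. For any $S$-terms $t_1,t_2$ with $t\preceq t_1$ and $t\preceq t_2$, there exists an $S$-term $t_3$ with $\mathrm{dc}(t_3)=\mathrm{dc}(t)$ whose connection word satisfies $\mathrm{cnc}(t_3)(i)=\max\{\mathrm{cnc}(t_1)(i),\mathrm{cnc}(t_2)(i)\}$ for all $i$, and $t\preceq t_3$; i.e. the operation $t_1\vee t_2:=t_3$ is well defined on $\{t'\in T(S):t\preceq t'\}$.
   Context: A signature is a set $S$ with an arity map $|\cdot|:S\to\mathbb N$. An $S$-term is either the leaf $\ell$ or $s\,t_1\cdots t_{|s|}$ with $s\in S$ and $S$-terms $t_i$; $T(S)$ is the set of $S$-terms. Internal nodes are numbered $1,\dots,\deg t$ in preorder (root, then subterms left to right); $\mathrm{dc}(t)$ is the word of decorations. Children (leaves included) are numbered from $1$ left to right; the parent edge of node $i$ is $(\mathrm{pa}(i),\mathrm{lp}(i),i)$, $i$ being the $\mathrm{lp}(i)$-th child of $\mathrm{pa}(i)$, with $\mathrm{pa}(1)=1,\mathrm{lp}(1)=0$. $\mathrm{cnc}(t)(i)=\mathrm{pa}(i)+1-2^{\mathrm{lp}(i)-a}$ with $a$ the arity of the decoration of $\mathrm{pa}(i)$; $t_1\preceq t_2$ iff $\mathrm{dc}(t_1)=\mathrm{dc}(t_2)$ and $\mathrm{cnc}(t_1)\le\mathrm{cnc}(t_2)$ componentwise. -}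

module Defs where

open import Data.Nat using (ℕ; zero; suc; _+_; _∸_)
open import Data.Integer using (+_)
open import Data.Rational using (ℚ; _/_; _-_; _*_; _≤_; _⊔_; 1ℚ; ½)
open import Data.List using (List; []; _∷_; _++_; zipWith)
open import Data.List.Relation.Binary.Pointwise using (Pointwise)
open import Data.Vec using (Vec; []; _∷_)
open import Data.Product using (_×_)
open import Relation.Binary.PropositionalEquality using (_≡_)
open import Level using (Level)

record Signature (ℓ : Level) : Set (Level.suc ℓ) where
  field
    Sym   : Set ℓ
    arity : Sym → ℕ

module _ {ℓ : Level} (S : Signature ℓ) where
  open Signature S

  data Term : Set ℓ where
    leaf : Term
    node : (s : Sym) → Vec Term (arity s) → Term

  mutual
    deg : Term → ℕ
    deg leaf = 0
    deg (node s ts) = suc (degs ts)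

    degs : ∀ {n} → Vec Term n → ℕ
    degs [] = 0
    degs (t ∷ ts) = deg t + degs ts

  mutual
    dc : Term → List Sym
    dc leaf = []
    dc (node s ts) = s ∷ dcs ts

    dcs : ∀ {n} → Vec Term n → List Sym
    dcs [] = []
    dcs (t ∷ ts) = dc t ++ dcs ts

  pow2inv : ℕ → ℚ
  pow2inv zero = 1ℚ
  pow2inv (suc k) = ½ * pow2inv (k)

  -- value pa + 1 - 2^(lp - a)   (lp ≤ a always holds here)
  cncVal : (pa lp a : ℕ) → ℚ
  cncVal pa lp a = ((+ (suc pa)) / 1) - pow2inv (a ∸ lp)

  mutual
    -- cncT t i p l a : connection values of the internal nodes of t (in
    -- preorder), where the root of t has preorder number i, is the l-th child
    -- of node p, and a is the arity of the decoration of p.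
    cncT : Term → (i p l a : ℕ) → List ℚ
    cncT leaf i p l a = []
    cncT (node s ts) i p l a = cncVal p l a ∷ cncs ts (suc i) i 1 (arity s)

    -- children list: j = preorder number of next internal node, p = parent
    -- number, k = position of the current child, a = arity of the parent.
    cncs : ∀ {n} → Vec Term n → (j p k a : ℕ) → List ℚ
    cncs [] j p k a = []
    cncs (t ∷ ts) j p k a = cncT t j p k a ++ cncs ts (j + deg t) p (suc k) a

  rootArity : Term → ℕ
  rootArity leaf = 0
  rootArity (node s ts) = arity s

  -- connection word; root: pa(1) = 1, lp(1) = 0, a = arity of root decoration
  cnc : Term → List ℚ
  cnc t = cncT t 1 1 0 (rootArity t)

  _⪯_ : Term → Term → Set ℓ
  t₁ ⪯ t₂ = (dc t₁ ≡ dc t₂) × Pointwise _≤_ (cnc t₁) (cnc t₂)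

-- Record node i of a term by its parent edge (pa(i), lp(i)) together with the arity
-- of the decoration of pa(i).  The connection value cnc(t)(i) lies in [pa(i), pa(i)+1)
-- and decreases strictly with lp(i), so it determines the edge, and taking the pointwise
-- maximum of two connection words amounts to choosing, node by node, the edge of larger
-- value.  A list of edges numbered 1, …, n in preorder comes from a term with decoration
-- word d as soon as every edge points to an earlier node of d of the right arity and the
-- list is nested: cnc(i) < cnc(j) whenever pa(i) < j < i.  Nestedness survives the
-- pointwise choice, because the condition at i is inherited from the term the chosen
-- edge came from, and the values at the intermediate nodes j can only grow.  Conversely
-- a nested list is decoded node by node: all nodes after pa(i) lie in the subtree of
-- pa(i) at positions before lp(i), so the lp(i)-th child of pa(i) is still a leaf of
-- the term built so far, and node i is grafted there.

module Submission where

open import Defs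
open import Level using (Level)
open import Data.Nat as ℕ using (ℕ; zero; suc; _+_; _∸_; _≤_; _<_; z≤n; s≤s; _<?_)
import Data.Nat.Properties as ℕ
import Data.Nat.Coprimality as Coprime
open import Data.Integer as ℤ using (1ℤ)
import Data.Integer.Properties as ℤ
open import Data.Integer.Tactic.RingSolver using (solve-∀)
open import Data.Rational as ℚ using (ℚ; mkℚ; _/_; _⊔_; 1ℚ; 0ℚ; ½)
import Data.Rational.Properties as ℚ
import Data.Rational.Unnormalised as ℚᵘ
import Data.Rational.Unnormalised.Properties as ℚᵘ
open import Data.List using (List; []; _∷_; _++_; _∷ʳ_; [_]; map; length; zipWith)
import Data.List.Properties as List
open import Data.List.Membership.Propositional using (_∈_)
open import Data.List.Membership.Propositional.Properties using (∈-++⁺ˡ; ∈-++⁺ʳ; ∈-++⁻)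
open import Data.List.Relation.Unary.Any using (here; there)
open import Data.List.Relation.Binary.Pointwise using (Pointwise; []; _∷_)
open import Data.List.Reverse using (Reverse; []; _∶_∶ʳ_; reverseView)
open import Data.Maybe as Maybe using (Maybe; just; nothing)
open import Data.Vec as Vec using (Vec; []; _∷_)
open import Data.Vec.Relation.Unary.All using (All; []; _∷_)
open import Data.Product using (Σ; ∃₂; _×_; _,_; proj₁; proj₂)
open import Data.Sum using (_⊎_; inj₁; inj₂)
open import Data.Unit using (⊤; tt)
open import Data.Empty using (⊥-elim)
open import Relation.Nullary using (yes; no)
open import Relation.Nullary.Decidable using (toWitness)
open import Relation.Binary.PropositionalEquality hiding ([_])

nth : ∀ {a} {A : Set a} → List A → ℕ → Maybe A
nth []       _       = nothing
nth (x ∷ xs) zero    = just x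
nth (x ∷ xs) (suc m) = nth xs m

nth-++ˡ : ∀ {a} {A : Set a} (xs ys : List A) {m} → m < length xs → nth (xs ++ ys) m ≡ nth xs m
nth-++ˡ (x ∷ xs) ys {zero}  _       = refl
nth-++ˡ (x ∷ xs) ys {suc m} (s≤s h) = nth-++ˡ xs ys h

nth-++ʳ : ∀ {a} {A : Set a} (xs ys : List A) m → nth (xs ++ ys) (length xs + m) ≡ nth ys m
nth-++ʳ []       ys m = refl
nth-++ʳ (x ∷ xs) ys m = nth-++ʳ xs ys m

∈-zipWith⁻ : ∀ {a b c r} {A : Set a} {B : Set b} {C : Set c} {R : A → B → Set r} {f : A → B → C} {xs ys z} →
             Pointwise R xs ys → z ∈ zipWith f xs ys → ∃₂ λ x y → x ∈ xs × y ∈ ys × R x y × z ≡ f x y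
∈-zipWith⁻ (Rxy ∷ _)   (here refl) = _ , _ , here refl , here refl , Rxy , refl
∈-zipWith⁻ (_ ∷ Rxsys) (there z∈) with ∈-zipWith⁻ Rxsys z∈
... | x , y , x∈ , y∈ , Rxy , z≡ = x , y , there x∈ , there y∈ , Rxy , z≡

Pointwise-≤-⊔ : ∀ {as bs cs} → Pointwise ℚ._≤_ as bs → Pointwise ℚ._≤_ as cs → Pointwise ℚ._≤_ as (zipWith _⊔_ bs cs)
Pointwise-≤-⊔ []         []         = []
Pointwise-≤-⊔ (a≤b ∷ ps) (a≤c ∷ qs) = ℚ.≤-trans a≤b (ℚ.p≤p⊔q _ _) ∷ Pointwise-≤-⊔ ps qs

-- Order of connection values

fromℕ : ℕ → ℚ
fromℕ n = ℤ.+ n / 1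

fromℕ-mkℚ : ∀ n → fromℕ n ≡ mkℚ (ℤ.+ n) 0 (Coprime.sym (Coprime.1-coprimeTo n))
fromℕ-mkℚ n = ℚ.normalize-coprime (Coprime.sym (Coprime.1-coprimeTo n))

fromℕ-suc : ∀ n → fromℕ n ℚ.+ 1ℚ ≡ fromℕ (suc n)
fromℕ-suc n = ℚ.toℚᵘ-injective (begin-equality
  ℚ.toℚᵘ (fromℕ n ℚ.+ 1ℚ)       ≃⟨ ℚ.toℚᵘ-homo-+ (fromℕ n) 1ℚ ⟩
  ℚ.toℚᵘ (fromℕ n) ℚᵘ.+ ℚᵘ.1ℚᵘ  ≡⟨ cong (λ q → ℚ.toℚᵘ q ℚᵘ.+ ℚᵘ.1ℚᵘ) (fromℕ-mkℚ n) ⟩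
  ℚᵘ.mkℚᵘ (ℤ.+ n) 0 ℚᵘ.+ ℚᵘ.1ℚᵘ ≃⟨ ℚᵘ.*≡* (sum-identity (ℤ.+ n)) ⟩
  ℚᵘ.mkℚᵘ (ℤ.+ n ℤ.+ 1ℤ) 0      ≡⟨ cong (λ z → ℚᵘ.mkℚᵘ z 0) (ℤ.pos-+ n 1) ⟩
  ℚᵘ.mkℚᵘ (ℤ.+ (n + 1)) 0       ≡⟨ cong ℚ.toℚᵘ (sym (fromℕ-mkℚ (n + 1))) ⟩
  ℚ.toℚᵘ (fromℕ (n + 1))        ≡⟨ cong (λ m → ℚ.toℚᵘ (fromℕ m)) (ℕ.+-comm n 1) ⟩
  ℚ.toℚᵘ (fromℕ (suc n))        ∎)
  where
  open ℚᵘ.≤-Reasoning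
  sum-identity : ∀ x → (x ℤ.* 1ℤ ℤ.+ 1ℤ ℤ.* 1ℤ) ℤ.* 1ℤ ≡ (x ℤ.+ 1ℤ) ℤ.* (1ℤ ℤ.* 1ℤ)
  sum-identity = solve-∀

fromℕ-mono-≤ : ∀ {m n} → m ≤ n → fromℕ m ℚ.≤ fromℕ n
fromℕ-mono-≤ {m} {n} m≤n rewrite fromℕ-mkℚ m | fromℕ-mkℚ n =
  ℚ.*≤* (ℤ.*-monoʳ-≤-nonNeg 1ℤ (ℤ.+≤+ m≤n))

p-q<p : ∀ x {w} → 0ℚ ℚ.< w → x ℚ.- w ℚ.< x
p-q<p x 0<w = subst (x ℚ.- _ ℚ.<_) (ℚ.+-identityʳ x) (ℚ.+-monoʳ-< x (ℚ.neg-antimono-< 0<w))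

sub-antimonoʳ-≤ : ∀ x {v w} → v ℚ.≤ w → x ℚ.- w ℚ.≤ x ℚ.- v
sub-antimonoʳ-≤ x v≤w = ℚ.+-monoʳ-≤ x (ℚ.neg-antimono-≤ v≤w)

sub-antimonoʳ-< : ∀ x {v w} → v ℚ.< w → x ℚ.- w ℚ.< x ℚ.- v
sub-antimonoʳ-< x v<w = ℚ.+-monoʳ-< x (ℚ.neg-antimono-< v<w)

p+q-q≡p : ∀ x y → (x ℚ.+ y) ℚ.- y ≡ x
p+q-q≡p x y = begin
  (x ℚ.+ y) ℚ.- y    ≡⟨ ℚ.+-assoc x y (ℚ.- y) ⟩
  x ℚ.+ (y ℚ.- y)    ≡⟨ cong (x ℚ.+_) (ℚ.+-inverseʳ y) ⟩
  x ℚ.+ 0ℚ           ≡⟨ ℚ.+-identityʳ x ⟩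
  x                  ∎
  where open ≡-Reasoning

module _ {ℓ : Level} (S : Signature ℓ) where
  open Signature S

  private
    2^-_ : ℕ → ℚ
    2^- n = pow2inv S n

  pow2inv-positive : ∀ n → ℚ.Positive (2^- n)
  pow2inv-positive zero    = _
  pow2inv-positive (suc n) = ℚ.pos*pos⇒pos ½ (2^- n) {{pow2inv-positive n}}

  pow2inv-suc-< : ∀ n → 2^- suc n ℚ.< 2^- n
  pow2inv-suc-< n = subst (½ ℚ.* 2^- n ℚ.<_) (ℚ.*-identityˡ (2^- n))
    (ℚ.*-monoˡ-<-pos (2^- n) {{pow2inv-positive n}} (toWitness {a? = ½ ℚ.<? 1ℚ} _))

  pow2inv-antimono-< : ∀ {m n} → m < n → 2^- n ℚ.< 2^- m
  pow2inv-antimono-< {m} {suc n} (s≤s m≤n) with ℕ.m≤n⇒m<n∨m≡n m≤n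
  ... | inj₂ refl = pow2inv-suc-< n
  ... | inj₁ m<n  = ℚ.<-trans (pow2inv-suc-< n) (pow2inv-antimono-< m<n)

  pow2inv-antimono-≤ : ∀ {m n} → m ≤ n → 2^- n ℚ.≤ 2^- m
  pow2inv-antimono-≤ m≤n with ℕ.m≤n⇒m<n∨m≡n m≤n
  ... | inj₂ refl = ℚ.≤-refl
  ... | inj₁ m<n  = ℚ.<⇒≤ (pow2inv-antimono-< m<n)

  cncVal<fromℕ-suc : ∀ p l a → cncVal S p l a ℚ.< fromℕ (suc p)
  cncVal<fromℕ-suc p l a = p-q<p (fromℕ (suc p)) (ℚ.positive⁻¹ (2^- (a ∸ l)) {{pow2inv-positive (a ∸ l)}})

  fromℕ≤cncVal : ∀ p l a → fromℕ p ℚ.≤ cncVal S p l a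
  fromℕ≤cncVal p l a = subst (ℚ._≤ cncVal S p l a)
    (trans (cong (ℚ._- 1ℚ) (sym (fromℕ-suc p))) (p+q-q≡p (fromℕ p) 1ℚ))
    (sub-antimonoʳ-≤ (fromℕ (suc p)) (pow2inv-antimono-≤ {0} {a ∸ l} z≤n))

  cncVal-parent-< : ∀ {p q} l a l′ a′ → p < q → cncVal S p l a ℚ.< cncVal S q l′ a′
  cncVal-parent-< {p} {q} l a l′ a′ p<q = ℚ.<-≤-trans (cncVal<fromℕ-suc p l a)
    (ℚ.≤-trans (fromℕ-mono-≤ p<q) (fromℕ≤cncVal q l′ a′))

  cncVal-position-< : ∀ p {l l′} a → l < l′ → l′ ≤ a → cncVal S p l′ a ℚ.< cncVal S p l a
  cncVal-position-< p a l<l′ l′≤a = sub-antimonoʳ-< (fromℕ (suc p)) (pow2inv-antimono-< (ℕ.∸-monoʳ-< l<l′ l′≤a))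

  cncVal-position-≤ : ∀ p {l l′} a → l ≤ l′ → cncVal S p l′ a ℚ.≤ cncVal S p l a
  cncVal-position-≤ p a l≤l′ = sub-antimonoʳ-≤ (fromℕ (suc p)) (pow2inv-antimono-≤ (ℕ.∸-monoʳ-≤ a l≤l′))

  -- Edge lists of terms

  record NodeArity (ds : List Sym) (i P a : ℕ) : Set where
    constructor at
    field
      offset : ℕ
      P≡i+offset : P ≡ i + offset
      arity≡ : Maybe.map arity (nth ds offset) ≡ just a

  NodeArity-≥ : ∀ {ds i P a} → NodeArity ds i P a → i ≤ P
  NodeArity-≥ {i = i} (at m refl _) = ℕ.m≤m+n i m

  NodeArity-++⁺ˡ : ∀ xs ys {i P a} → P < i + length xs → NodeArity xs i P a → NodeArity (xs ++ ys) i P a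
  NodeArity-++⁺ˡ xs ys {i} P< (at m refl q) =
    at m refl (trans (cong (Maybe.map arity) (nth-++ˡ xs ys (ℕ.+-cancelˡ-< i m (length xs) P<))) q)

  NodeArity-++⁻ˡ : ∀ xs ys {i P a} → P < i + length xs → NodeArity (xs ++ ys) i P a → NodeArity xs i P a
  NodeArity-++⁻ˡ xs ys {i} P< (at m refl q) =
    at m refl (trans (cong (Maybe.map arity) (sym (nth-++ˡ xs ys (ℕ.+-cancelˡ-< i m (length xs) P<)))) q)

  NodeArity-++⁺ʳ : ∀ xs ys {i P a} → NodeArity ys (i + length xs) P a → NodeArity (xs ++ ys) i P a
  NodeArity-++⁺ʳ xs ys {i} (at m refl q) =
    at (length xs + m) (ℕ.+-assoc i (length xs) m) (trans (cong (Maybe.map arity) (nth-++ʳ xs ys m)) q)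

  NodeArity-++⁻ʳ : ∀ xs ys {i P a} → i + length xs ≤ P → NodeArity (xs ++ ys) i P a → NodeArity ys (i + length xs) P a
  NodeArity-++⁻ʳ xs ys {i} {a = a} ≤P (at m refl q) =
    at (m ∸ length xs) shift (trans (cong (Maybe.map arity) (sym (nth-++ʳ xs ys _)))
                                    (subst (λ z → Maybe.map arity (nth (xs ++ ys) z) ≡ just a) m≡ q))
    where
    m≡ : m ≡ length xs + (m ∸ length xs)
    m≡ = sym (ℕ.m+[n∸m]≡n (ℕ.+-cancelˡ-≤ i (length xs) m ≤P))
    shift : i + m ≡ i + length xs + (m ∸ length xs)
    shift = trans (cong (i +_) m≡) (sym (ℕ.+-assoc i (length xs) _))

  NodeArity-∷⁺ : ∀ s ds {i P a} → NodeArity ds (suc i) P a → NodeArity (s ∷ ds) i P a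
  NodeArity-∷⁺ s ds {i} (at m refl q) = at (suc m) (sym (ℕ.+-suc i m)) q

  NodeArity-∷⁻ : ∀ s ds {i P a} → i < P → NodeArity (s ∷ ds) i P a → NodeArity ds (suc i) P a
  NodeArity-∷⁻ s ds {i} i<P (at zero refl q) = ⊥-elim (ℕ.<-irrefl (sym (ℕ.+-identityʳ i)) i<P)
  NodeArity-∷⁻ s ds {i} i<P (at (suc m) refl q) = at m (ℕ.+-suc i m) q

  record Edge : Set where
    constructor edge
    field
      index parent position parentArity : ℕ
  open Edge public

  -- Opaque: unfolding the normalising division inside cncVal during unification
  -- makes type checking blow up.
  opaque
    value : Edge → ℚ
    value e = cncVal S (parent e) (position e) (parentArity e)

    value≡cncVal : ∀ e → value e ≡ cncVal S (parent e) (position e) (parentArity e)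
    value≡cncVal e = refl

  mutual
    termEdges : Term S → (i p l a : ℕ) → List Edge
    termEdges leaf        i p l a = []
    termEdges (node s ts) i p l a = edge i p l a ∷ forestEdges ts (suc i) i 1 (arity s)

    forestEdges : ∀ {n} → Vec (Term S) n → (j p k a : ℕ) → List Edge
    forestEdges []       j p k a = []
    forestEdges (t ∷ ts) j p k a = termEdges t j p k a ++ forestEdges ts (j + deg S t) p (suc k) a

  edges : Term S → List Edge
  edges t = termEdges t 1 1 0 (rootArity S t)

  mutual
    cncT≡map-value : ∀ t i p l a → cncT S t i p l a ≡ map value (termEdges t i p l a)
    cncT≡map-value leaf        i p l a = refl
    cncT≡map-value (node s ts) i p l a = cong₂ _∷_ (sym (value≡cncVal (edge i p l a))) (cncs≡map-value ts (suc i) i 1 (arity s))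

    cncs≡map-value : ∀ {n} (ts : Vec (Term S) n) j p k a → cncs S ts j p k a ≡ map value (forestEdges ts j p k a)
    cncs≡map-value []       j p k a = refl
    cncs≡map-value (t ∷ ts) j p k a = begin
      cncT S t j p k a ++ cncs S ts _ p (suc k) a
        ≡⟨ cong₂ _++_ (cncT≡map-value t j p k a) (cncs≡map-value ts _ p (suc k) a) ⟩
      map value (termEdges t j p k a) ++ map value (forestEdges ts _ p (suc k) a)
        ≡⟨ List.map-++ value (termEdges t j p k a) _ ⟨
      map value (forestEdges (t ∷ ts) j p k a) ∎
      where open ≡-Reasoning

  cnc≡map-value-edges : ∀ t → cnc S t ≡ map value (edges t)
  cnc≡map-value-edges t = cncT≡map-value t 1 1 0 (rootArity S t)

  mutual
    length-termEdges : ∀ t i p l a → length (termEdges t i p l a) ≡ deg S t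
    length-termEdges leaf        i p l a = refl
    length-termEdges (node s ts) i p l a = cong suc (length-forestEdges ts (suc i) i 1 (arity s))

    length-forestEdges : ∀ {n} (ts : Vec (Term S) n) j p k a → length (forestEdges ts j p k a) ≡ degs S ts
    length-forestEdges []       j p k a = refl
    length-forestEdges (t ∷ ts) j p k a = trans (List.length-++ (termEdges t j p k a))
      (cong₂ _+_ (length-termEdges t j p k a) (length-forestEdges ts _ p (suc k) a))

  mutual
    length-dc : ∀ t → length (dc S t) ≡ deg S t
    length-dc leaf        = refl
    length-dc (node s ts) = cong suc (length-dcs ts)

    length-dcs : ∀ {n} (ts : Vec (Term S) n) → length (dcs S ts) ≡ degs S ts
    length-dcs []       = refl
    length-dcs (t ∷ ts) = trans (List.length-++ (dc S t)) (cong₂ _+_ (length-dc t) (length-dcs ts))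

  NumberedFrom : ℕ → List Edge → Set
  NumberedFrom j []      = ⊤
  NumberedFrom j (e ∷ E) = index e ≡ j × NumberedFrom (suc j) E

  NumberedFrom-++ : ∀ {j} xs {ys} → NumberedFrom j xs → NumberedFrom (j + length xs) ys → NumberedFrom j (xs ++ ys)
  NumberedFrom-++ {j} []       {ys} _         h = subst (λ z → NumberedFrom z ys) (ℕ.+-identityʳ j) h
  NumberedFrom-++ {j} (x ∷ xs) {ys} (x≡ , hx) h =
    x≡ , NumberedFrom-++ xs hx (subst (λ z → NumberedFrom z ys) (ℕ.+-suc j (length xs)) h)

  NumberedFrom-++⁻ : ∀ {j} xs {ys} → NumberedFrom j (xs ++ ys) → NumberedFrom j xs × NumberedFrom (j + length xs) ys
  NumberedFrom-++⁻ {j} []       {ys} h = tt , subst (λ z → NumberedFrom z ys) (sym (ℕ.+-identityʳ j)) h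
  NumberedFrom-++⁻ {j} (x ∷ xs) {ys} (x≡ , h) with NumberedFrom-++⁻ xs h
  ... | hx , hy = (x≡ , hx) , subst (λ z → NumberedFrom z ys) (sym (ℕ.+-suc j (length xs))) hy

  NumberedFrom-∈ : ∀ {j E e} → NumberedFrom j E → e ∈ E → j ≤ index e × index e < j + length E
  NumberedFrom-∈ {j} {x ∷ xs} (refl , _) (here refl) = ℕ.≤-refl , ℕ.m<m+n j (s≤s z≤n)
  NumberedFrom-∈ {j} {x ∷ xs} {e} (_ , hx) (there e∈) with NumberedFrom-∈ hx e∈
  ... | j<e , e< = ℕ.<⇒≤ j<e , subst (index e <_) (sym (ℕ.+-suc j (length xs))) e<

  mutual
    termEdges-numbered : ∀ t i p l a → NumberedFrom i (termEdges t i p l a)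
    termEdges-numbered leaf        i p l a = tt
    termEdges-numbered (node s ts) i p l a = refl , forestEdges-numbered ts (suc i) i 1 (arity s)

    forestEdges-numbered : ∀ {n} (ts : Vec (Term S) n) j p k a → NumberedFrom j (forestEdges ts j p k a)
    forestEdges-numbered []       j p k a = tt
    forestEdges-numbered (t ∷ ts) j p k a = NumberedFrom-++ (termEdges t j p k a) (termEdges-numbered t j p k a)
      (subst (λ z → NumberedFrom (j + z) (forestEdges ts (j + deg S t) p (suc k) a)) (sym (length-termEdges t j p k a))
        (forestEdges-numbered ts (j + deg S t) p (suc k) a))

  termEdges-range : ∀ t {i p l a e} → e ∈ termEdges t i p l a → i ≤ index e × index e < i + deg S t
  termEdges-range t {i} {p} {l} {a} e∈ = subst (λ n → _ × _ < i + n) (length-termEdges t i p l a)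
    (NumberedFrom-∈ (termEdges-numbered t i p l a) e∈)

  forestEdges-range : ∀ {n} (ts : Vec (Term S) n) {j p k a e} → e ∈ forestEdges ts j p k a → j ≤ index e × index e < j + degs S ts
  forestEdges-range ts {j} {p} {k} {a} e∈ = subst (λ n → _ × _ < j + n) (length-forestEdges ts j p k a)
    (NumberedFrom-∈ (forestEdges-numbered ts j p k a) e∈)

  record IsInnerEdge (ds : List Sym) (i : ℕ) (e : Edge) : Set where
    constructor inner
    field
      parent<index   : parent e < index e
      1≤position     : 1 ≤ position e
      position≤arity : position e ≤ parentArity e
      arityOfParent  : NodeArity ds i (parent e) (parentArity e)

  record IsChildEdge (p a k n : ℕ) (e : Edge) : Set where
    constructor child
    field
      parent≡      : parent e ≡ p
      parentArity≡ : parentArity e ≡ a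
      k≤position   : k ≤ position e
      position<    : position e < k + n

  mutual
    termEdge-cases : ∀ t {i p l a e} → e ∈ termEdges t i p l a → e ≡ edge i p l a ⊎ IsInnerEdge (dc S t) i e
    termEdge-cases (node s ts) (here refl) = inj₁ refl
    termEdge-cases (node s ts) {i} (there e∈) with forestEdge-cases ts e∈
    ... | inj₁ (child refl refl 1≤pos pos<) =
      inj₂ (inner (proj₁ (forestEdges-range ts e∈)) 1≤pos (ℕ.s≤s⁻¹ pos<) (at 0 (sym (ℕ.+-identityʳ i)) refl))
    ... | inj₂ (inner p<i 1≤pos pos≤ ar) = inj₂ (inner p<i 1≤pos pos≤ (NodeArity-∷⁺ s (dcs S ts) ar))

    forestEdge-cases : ∀ {n} (ts : Vec (Term S) n) {j p k a e} → e ∈ forestEdges ts j p k a →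
                       IsChildEdge p a k n e ⊎ IsInnerEdge (dcs S ts) j e
    forestEdge-cases (t ∷ ts) {j} {p} {k} {a} e∈ with ∈-++⁻ (termEdges t j p k a) e∈
    ... | inj₁ e∈t with termEdge-cases t e∈t
    ...   | inj₁ refl = inj₁ (child refl refl ℕ.≤-refl (ℕ.m<m+n k (s≤s z≤n)))
    ...   | inj₂ (inner p<i 1≤pos pos≤ ar) = inj₂ (inner p<i 1≤pos pos≤ (NodeArity-++⁺ˡ (dc S t) (dcs S ts) parent< ar))
      where
      parent< : _ < j + length (dc S t)
      parent< = subst (λ n → _ < j + n) (sym (length-dc t)) (ℕ.<-trans p<i (proj₂ (termEdges-range t e∈t)))
    forestEdge-cases {suc n} (t ∷ ts) {j} {k = k} {e = e} e∈ | inj₂ e∈ts with forestEdge-cases ts e∈ts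
    ...   | inj₁ (child refl refl k<pos pos<) =
      inj₁ (child refl refl (ℕ.<⇒≤ k<pos) (subst (position e <_) (sym (ℕ.+-suc k n)) pos<))
    ...   | inj₂ (inner p<i 1≤pos pos≤ ar) = inj₂ (inner p<i 1≤pos pos≤
            (NodeArity-++⁺ʳ (dc S t) (dcs S ts)
              (subst (λ z → NodeArity (dcs S ts) (j + z) (parent e) (parentArity e)) (sym (length-dc t)) ar)))

  Nested : List Edge → Set
  Nested E = ∀ {e e′} → e ∈ E → e′ ∈ E → parent e < index e′ → index e′ < index e → value e ℚ.< value e′

  mutual
    termEdges-nested : ∀ t i p l a → Nested (termEdges t i p l a)
    termEdges-nested (node s ts) i p l a (here refl) (here refl) _ i<i = ⊥-elim (ℕ.<-irrefl refl i<i)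
    termEdges-nested (node s ts) i p l a (here refl) (there e′∈) _ e′<i =
      ⊥-elim (ℕ.<-asym e′<i (proj₁ (forestEdges-range ts e′∈)))
    termEdges-nested (node s ts) i p l a (there e∈) (here refl) pe<i _ with forestEdge-cases ts e∈
    ... | inj₁ (child refl _ _ _)     = ⊥-elim (ℕ.<-irrefl refl pe<i)
    ... | inj₂ (inner _ _ _ ar)       = ⊥-elim (ℕ.<-asym pe<i (NodeArity-≥ ar))
    termEdges-nested (node s ts) i p l a (there e∈) (there e′∈) =
      forestEdges-nested ts (suc i) i 1 (arity s) (ℕ.n<1+n i) ℕ.≤-refl e∈ e′∈

    forestEdges-nested : ∀ {n} (ts : Vec (Term S) n) j p k a → p < j → k + n ≤ suc a → Nested (forestEdges ts j p k a)
    forestEdges-nested {suc n} (t ∷ ts) j p k a p<j k+n≤ {e} {e′} e∈ e′∈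
      with ∈-++⁻ (termEdges t j p k a) e∈ | ∈-++⁻ (termEdges t j p k a) e′∈
    ... | inj₁ e∈t  | inj₁ e′∈t  = termEdges-nested t j p k a e∈t e′∈t
    ... | inj₂ e∈ts | inj₂ e′∈ts =
      forestEdges-nested ts (j + deg S t) p (suc k) a (ℕ.<-≤-trans p<j (ℕ.m≤m+n j _))
        (subst (_≤ suc a) (ℕ.+-suc k n) k+n≤) e∈ts e′∈ts
    ... | inj₁ e∈t  | inj₂ e′∈ts = λ _ e′<e →
      ⊥-elim (ℕ.<-asym e′<e (ℕ.<-≤-trans (proj₂ (termEdges-range t e∈t)) (proj₁ (forestEdges-range ts e′∈ts))))
    ... | inj₂ e∈ts | inj₁ e′∈t with forestEdge-cases ts e∈ts
    ...   | inj₂ (inner _ _ _ ar) = λ pe<e′ _ →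
      ⊥-elim (ℕ.<-asym pe<e′ (ℕ.<-≤-trans (proj₂ (termEdges-range t e′∈t)) (NodeArity-≥ ar)))
    ...   | inj₁ (child refl refl k<pos pos<) with termEdge-cases t e′∈t
    ...     | inj₁ refl = λ _ _ → subst₂ ℚ._<_ (sym (value≡cncVal e)) (sym (value≡cncVal e′))
                (cncVal-position-< p a k<pos (ℕ.s≤s⁻¹ (ℕ.≤-trans pos< (subst (_≤ suc a) (ℕ.+-suc k n) k+n≤))))
    ...     | inj₂ (inner _ _ _ ar) = λ _ _ → subst₂ ℚ._<_ (sym (value≡cncVal e)) (sym (value≡cncVal e′))
                (cncVal-parent-< (position e) a (position e′) (parentArity e′) (ℕ.<-≤-trans p<j (NodeArity-≥ ar)))

  -- Pointwise join of edge lists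

  infixl 6 _⊔ₑ_
  _⊔ₑ_ : Edge → Edge → Edge
  x ⊔ₑ y with value x ℚ.≤? value y
  ... | yes _ = y
  ... | no  _ = x

  ⊔ₑ-sel : ∀ x y → x ⊔ₑ y ≡ x ⊎ x ⊔ₑ y ≡ y
  ⊔ₑ-sel x y with value x ℚ.≤? value y
  ... | yes _ = inj₂ refl
  ... | no  _ = inj₁ refl

  value-⊔ₑ : ∀ x y → value (x ⊔ₑ y) ≡ value x ⊔ value y
  value-⊔ₑ x y with value x ℚ.≤? value y
  ... | yes x≤y = sym (ℚ.p≤q⇒p⊔q≡q x≤y)
  ... | no  x≰y = sym (ℚ.p≥q⇒p⊔q≡p (ℚ.<⇒≤ (ℚ.≰⇒> x≰y)))

  value-≤-⊔ₑˡ : ∀ x y → value x ℚ.≤ value (x ⊔ₑ y)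
  value-≤-⊔ₑˡ x y = subst (value x ℚ.≤_) (sym (value-⊔ₑ x y)) (ℚ.p≤p⊔q (value x) (value y))

  value-≤-⊔ₑʳ : ∀ x y → value y ℚ.≤ value (x ⊔ₑ y)
  value-≤-⊔ₑʳ x y = subst (value y ℚ.≤_) (sym (value-⊔ₑ x y)) (ℚ.p≤q⊔p (value x) (value y))

  index-⊔ₑ : ∀ x y → index x ≡ index y → index (x ⊔ₑ y) ≡ index x
  index-⊔ₑ x y x≡y with ⊔ₑ-sel x y
  ... | inj₁ eq = cong index eq
  ... | inj₂ eq = trans (cong index eq) (sym x≡y)

  map-value-⊔ₑ : ∀ xs ys → map value (zipWith _⊔ₑ_ xs ys) ≡ zipWith _⊔_ (map value xs) (map value ys)
  map-value-⊔ₑ xs ys = begin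
    map value (zipWith _⊔ₑ_ xs ys)                    ≡⟨ List.map-zipWith _⊔ₑ_ value xs ys ⟩
    zipWith (λ x y → value (x ⊔ₑ y)) xs ys            ≡⟨ List.zipWith-cong value-⊔ₑ xs ys ⟩
    zipWith (λ x y → value x ⊔ value y) xs ys         ≡⟨ List.zipWith-map _⊔_ value value xs ys ⟨
    zipWith _⊔_ (map value xs) (map value ys)         ∎
    where open ≡-Reasoning

  SameIndex : Edge → Edge → Set
  SameIndex x y = index x ≡ index y

  NumberedFrom-sameIndex : ∀ {j xs ys} → length xs ≡ length ys → NumberedFrom j xs → NumberedFrom j ys →
                           Pointwise SameIndex xs ys
  NumberedFrom-sameIndex {xs = []}     {[]}     _      _         _         = []
  NumberedFrom-sameIndex {xs = x ∷ xs} {y ∷ ys} len≡ (x≡ , hx) (y≡ , hy) =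
    trans x≡ (sym y≡) ∷ NumberedFrom-sameIndex (ℕ.suc-injective len≡) hx hy

  NumberedFrom-⊔ₑ : ∀ {j xs ys} → NumberedFrom j xs → NumberedFrom j ys → NumberedFrom j (zipWith _⊔ₑ_ xs ys)
  NumberedFrom-⊔ₑ {xs = []}     {ys}     _         _         = tt
  NumberedFrom-⊔ₑ {xs = x ∷ xs} {[]}     _         _         = tt
  NumberedFrom-⊔ₑ {xs = x ∷ xs} {y ∷ ys} (x≡ , hx) (y≡ , hy) =
    trans (index-⊔ₑ x y (trans x≡ (sym y≡))) x≡ , NumberedFrom-⊔ₑ hx hy

  Nested-⊔ₑ : ∀ {xs ys} → Pointwise SameIndex xs ys → Nested xs → Nested ys → Nested (zipWith _⊔ₑ_ xs ys)
  Nested-⊔ₑ same nested-xs nested-ys e∈ e′∈ pe<e′ e′<e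
    with ∈-zipWith⁻ same e∈ | ∈-zipWith⁻ same e′∈
  ... | x , y , x∈ , y∈ , x≡y , refl | x′ , y′ , x′∈ , y′∈ , x′≡y′ , refl with ⊔ₑ-sel x y
  ...   | inj₁ e≡x = subst (λ e → value e ℚ.< value (x′ ⊔ₑ y′)) (sym e≡x) (ℚ.<-≤-trans
            (nested-xs x∈ x′∈ (subst₂ _<_ (cong parent e≡x) index-e′ pe<e′) (subst₂ _<_ index-e′ index-e e′<e))
            (value-≤-⊔ₑˡ x′ y′))
    where
    index-e : index (x ⊔ₑ y) ≡ index x
    index-e = index-⊔ₑ x y x≡y
    index-e′ : index (x′ ⊔ₑ y′) ≡ index x′
    index-e′ = index-⊔ₑ x′ y′ x′≡y′
  ...   | inj₂ e≡y = subst (λ e → value e ℚ.< value (x′ ⊔ₑ y′)) (sym e≡y) (ℚ.<-≤-trans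
            (nested-ys y∈ y′∈ (subst₂ _<_ (cong parent e≡y) index-e′ pe<e′) (subst₂ _<_ index-e′ index-e e′<e))
            (value-≤-⊔ₑʳ x′ y′))
    where
    index-e : index (x ⊔ₑ y) ≡ index y
    index-e = trans (index-⊔ₑ x y x≡y) x≡y
    index-e′ : index (x′ ⊔ₑ y′) ≡ index y′
    index-e′ = trans (index-⊔ₑ x′ y′ x′≡y′) x′≡y′

  -- Grafting a node

  Leaves : ∀ {n} → Vec (Term S) n → Set ℓ
  Leaves = All (_≡ leaf)

  replicate-leaves : ∀ n → Leaves (Vec.replicate n leaf)
  replicate-leaves zero    = []
  replicate-leaves (suc n) = refl ∷ replicate-leaves n

  dcs-leaves : ∀ {n} {ts : Vec (Term S) n} → Leaves ts → dcs S ts ≡ []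
  dcs-leaves []         = refl
  dcs-leaves (refl ∷ h) = dcs-leaves h

  degs-leaves : ∀ {n} {ts : Vec (Term S) n} → Leaves ts → degs S ts ≡ 0
  degs-leaves []         = refl
  degs-leaves (refl ∷ h) = degs-leaves h

  forestEdges-leaves : ∀ {n} {ts : Vec (Term S) n} → Leaves ts → ∀ j p k a → forestEdges ts j p k a ≡ []
  forestEdges-leaves []         j p k a = refl
  forestEdges-leaves (refl ∷ h) j p k a = forestEdges-leaves h _ p (suc k) a

  AboveAfter : ℕ → ℚ → List Edge → Set
  AboveAfter X v E = ∀ {e} → e ∈ E → X < index e → v ℚ.< value e

  leaves-if-above : ∀ {n} (ts : Vec (Term S) n) j p k a {X v} → X < j → (∀ m → k ≤ m → cncVal S p m a ℚ.≤ v) →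
                    AboveAfter X v (forestEdges ts j p k a) → Leaves ts
  leaves-if-above []                j p k a X<j root≤v above = []
  leaves-if-above (leaf ∷ ts)       j p k a X<j root≤v above =
    refl ∷ leaves-if-above ts (j + 0) p (suc k) a (ℕ.<-≤-trans X<j (ℕ.m≤m+n j 0))
             (λ m k<m → root≤v m (ℕ.<⇒≤ k<m)) above
  leaves-if-above (node s us ∷ ts) j p k a X<j root≤v above =
    ⊥-elim (ℚ.<-irrefl refl (ℚ.<-≤-trans (above (here refl) X<j)
      (subst (ℚ._≤ _) (sym (value≡cncVal (edge j p k a))) (root≤v k ℕ.≤-refl))))

  Inserted : ∀ {n} → Vec (Term S) n → (j p k a : ℕ) → Sym → Edge → Set ℓ
  Inserted {n} ts j p k a sy e = Σ (Vec (Term S) n) λ ts′ →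
    dcs S ts′ ≡ dcs S ts ∷ʳ sy × forestEdges ts′ j p k a ≡ forestEdges ts j p k a ∷ʳ e

  Inserted-∷ : ∀ {n} t (ts : Vec (Term S) n) {j p k a sy e} →
               Inserted ts (j + deg S t) p (suc k) a sy e → Inserted (t ∷ ts) j p k a sy e
  Inserted-∷ t ts {j} {p} {k} {a} {sy} {e} (ts′ , dc≡ , edges≡) = t ∷ ts′ ,
    trans (cong (dc S t ++_) dc≡) (sym (List.++-assoc (dc S t) (dcs S ts) [ sy ])) ,
    trans (cong (termEdges t j p k a ++_) edges≡)
          (sym (List.++-assoc (termEdges t j p k a) (forestEdges ts (j + deg S t) p (suc k) a) [ e ]))

  Inserted-node : ∀ {n} s us (ts : Vec (Term S) n) {j p k a sy P L aP} → Leaves ts →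
                  Inserted us (suc j) j 1 (arity s) sy (edge (j + deg S (node s us)) P L aP) →
                  Inserted (node s us ∷ ts) j p k a sy (edge (j + degs S (node s us ∷ ts)) P L aP)
  Inserted-node s us ts {j} {p} {k} {a} {sy} {P} {L} {aP} ts-leaves (us′ , dc≡ , edges≡) =
    node s us′ ∷ ts , dc-eq , edges-eq
    where
    dc-eq : dcs S (node s us′ ∷ ts) ≡ dcs S (node s us ∷ ts) ∷ʳ sy
    dc-eq rewrite dcs-leaves ts-leaves | List.++-identityʳ (dcs S us′) | List.++-identityʳ (dcs S us) = cong (s ∷_) dc≡
    edges-eq : forestEdges (node s us′ ∷ ts) j p k a ≡
               forestEdges (node s us ∷ ts) j p k a ∷ʳ edge (j + degs S (node s us ∷ ts)) P L aP
    edges-eq = begin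
      termEdges (node s us′) j p k a ++ forestEdges ts (j + deg S (node s us′)) p (suc k) a
        ≡⟨ cong (termEdges (node s us′) j p k a ++_) (forestEdges-leaves ts-leaves _ p (suc k) a) ⟩
      termEdges (node s us′) j p k a ++ []
        ≡⟨ List.++-identityʳ _ ⟩
      edge j p k a ∷ forestEdges us′ (suc j) j 1 (arity s)
        ≡⟨ cong (edge j p k a ∷_) edges≡ ⟩
      termEdges (node s us) j p k a ∷ʳ edge (j + deg S (node s us)) P L aP
        ≡⟨ cong₂ (λ E n → E ∷ʳ edge (j + n) P L aP) (sym (List.++-identityʳ (termEdges (node s us) j p k a)))
             (sym (ℕ.+-identityʳ (deg S (node s us)))) ⟩
      (termEdges (node s us) j p k a ++ []) ∷ʳ edge (j + (deg S (node s us) + 0)) P L aP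
        ≡⟨ cong₂ (λ E n → (termEdges (node s us) j p k a ++ E) ∷ʳ edge (j + (deg S (node s us) + n)) P L aP)
             (sym (forestEdges-leaves ts-leaves _ p (suc k) a)) (sym (degs-leaves ts-leaves)) ⟩
      forestEdges (node s us ∷ ts) j p k a ∷ʳ edge (j + degs S (node s us ∷ ts)) P L aP ∎
      where open ≡-Reasoning

  insertChild : ∀ {n} (ts : Vec (Term S) n) j p k a {L} (sy : Sym) → p < j → k ≤ L → L < k + n →
                AboveAfter p (cncVal S p L a) (forestEdges ts j p k a) →
                Inserted ts j p k a sy (edge (j + degs S ts) p L a)
  insertChild []       j p k a sy p<j k≤L L< above =
    ⊥-elim (ℕ.<-irrefl refl (ℕ.<-≤-trans (subst (_ <_) (ℕ.+-identityʳ k) L<) k≤L))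
  insertChild {suc n} (t ∷ ts) j p k a {L} sy p<j k≤L L< above with ℕ.m≤n⇒m<n∨m≡n k≤L
  insertChild (node s us ∷ ts) j p k a sy p<j k≤L L< above | inj₂ refl =
    ⊥-elim (ℚ.<-irrefl (sym (value≡cncVal (edge j p k a))) (above (here refl) p<j))
  insertChild (leaf ∷ ts) j p k a sy p<j k≤L L< above | inj₂ refl =
    node sy (Vec.replicate (arity sy) leaf) ∷ ts , dc-eq , edges-eq
    where
    ts-leaves : Leaves ts
    ts-leaves = leaves-if-above ts (j + 0) p (suc k) a (ℕ.<-≤-trans p<j (ℕ.m≤m+n j 0))
                  (λ m k<m → cncVal-position-≤ p a (ℕ.<⇒≤ k<m)) above
    dc-eq : dcs S (node sy (Vec.replicate (arity sy) leaf) ∷ ts) ≡ dcs S ts ∷ʳ sy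
    dc-eq rewrite dcs-leaves (replicate-leaves (arity sy)) | dcs-leaves ts-leaves = refl
    edges-eq : forestEdges (node sy (Vec.replicate (arity sy) leaf) ∷ ts) j p k a ≡
               forestEdges ts (j + 0) p (suc k) a ∷ʳ edge (j + degs S ts) p k a
    edges-eq rewrite forestEdges-leaves (replicate-leaves (arity sy)) (suc j) j 1 (arity sy)
                   | forestEdges-leaves ts-leaves (j + deg S (node sy (Vec.replicate (arity sy) leaf))) p (suc k) a
                   | forestEdges-leaves ts-leaves (j + 0) p (suc k) a
                   | degs-leaves ts-leaves | ℕ.+-identityʳ j = refl
  insertChild {suc n} (t ∷ ts) j p k a {L} sy p<j k≤L L< above | inj₁ k<L =
    subst (λ i → Inserted (t ∷ ts) j p k a sy (edge i p L a)) (ℕ.+-assoc j (deg S t) (degs S ts))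
      (Inserted-∷ t ts (insertChild ts (j + deg S t) p (suc k) a sy (ℕ.<-≤-trans p<j (ℕ.m≤m+n j _)) k<L
        (subst (L <_) (ℕ.+-suc k n) L<) (λ e∈ → above (∈-++⁺ʳ (termEdges t j p k a) e∈))))

  mutual
    insertTerm : ∀ s (ts : Vec (Term S) (arity s)) i {P L aP} sy → P < i + deg S (node s ts) →
                 NodeArity (dc S (node s ts)) i P aP → 1 ≤ L → L ≤ aP →
                 AboveAfter P (cncVal S P L aP) (forestEdges ts (suc i) i 1 (arity s)) →
                 Inserted ts (suc i) i 1 (arity s) sy (edge (i + deg S (node s ts)) P L aP)
    insertTerm s ts i {L = L} sy P< (at zero P≡i+0 refl) 1≤L L≤a above with refl ← trans P≡i+0 (ℕ.+-identityʳ i) =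
      subst (λ n → Inserted ts (suc i) i 1 (arity s) sy (edge n i L (arity s))) (sym (ℕ.+-suc i (degs S ts)))
        (insertChild ts (suc i) i 1 (arity s) sy (ℕ.n<1+n i) 1≤L (s≤s L≤a) above)
    insertTerm s ts i {P} {L} {aP} sy P< ar@(at (suc m) P≡ _) 1≤L L≤a above =
      subst (λ n → Inserted ts (suc i) i 1 (arity s) sy (edge n P L aP)) (sym (ℕ.+-suc i (degs S ts)))
        (insertForest ts (suc i) i 1 (arity s) sy (ℕ.n<1+n i) i<P (subst (P <_) (ℕ.+-suc i (degs S ts)) P<)
          (NodeArity-∷⁻ s (dcs S ts) i<P ar) 1≤L L≤a above)
      where
      i<P : i < P
      i<P = subst (i <_) (sym P≡) (ℕ.m<m+n i (s≤s z≤n))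

    insertForest : ∀ {n} (ts : Vec (Term S) n) j p k a {P L aP} sy → p < j → j ≤ P → P < j + degs S ts →
                   NodeArity (dcs S ts) j P aP → 1 ≤ L → L ≤ aP →
                   AboveAfter P (cncVal S P L aP) (forestEdges ts j p k a) →
                   Inserted ts j p k a sy (edge (j + degs S ts) P L aP)
    insertForest [] j p k a sy p<j j≤P P< ar 1≤L L≤a above =
      ⊥-elim (ℕ.<-irrefl refl (ℕ.<-≤-trans (subst (_ <_) (ℕ.+-identityʳ j) P<) j≤P))
    insertForest (t ∷ ts) j p k a {P} sy p<j j≤P P< ar 1≤L L≤a above with P <? j + deg S t
    insertForest (leaf ∷ ts) j p k a sy p<j j≤P P< ar 1≤L L≤a above | yes P<t =
      ⊥-elim (ℕ.<-irrefl refl (ℕ.<-≤-trans (subst (_ <_) (ℕ.+-identityʳ j) P<t) j≤P))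
    insertForest (node s us ∷ ts) j p k a {P} {L} {aP} sy p<j j≤P P< ar 1≤L L≤a above | yes P<t =
      Inserted-node s us ts ts-leaves
        (insertTerm s us j sy P<t (NodeArity-++⁻ˡ (dc S (node s us)) (dcs S ts) P<dc ar) 1≤L L≤a
          (λ e∈ → above (∈-++⁺ˡ (there e∈))))
      where
      P<dc : P < j + length (dc S (node s us))
      P<dc = subst (λ n → P < j + n) (sym (length-dc (node s us))) P<t
      ts-leaves : Leaves ts
      ts-leaves = leaves-if-above ts (j + deg S (node s us)) p (suc k) a P<t
                    (λ m _ → ℚ.<⇒≤ (cncVal-parent-< m a L aP (ℕ.<-≤-trans p<j j≤P)))
                    (λ e∈ → above (∈-++⁺ʳ (termEdges (node s us) j p k a) e∈))
    insertForest (t ∷ ts) j p k a {P} {L} {aP} sy p<j j≤P P< ar 1≤L L≤a above | no P≮t =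
      subst (λ i → Inserted (t ∷ ts) j p k a sy (edge i P L aP)) (ℕ.+-assoc j (deg S t) (degs S ts))
        (Inserted-∷ t ts (insertForest ts (j + deg S t) p (suc k) a sy (ℕ.<-≤-trans p<j (ℕ.m≤m+n j _)) (ℕ.≮⇒≥ P≮t)
          (subst (P <_) (sym (ℕ.+-assoc j (deg S t) (degs S ts))) P<)
          (subst (λ n → NodeArity (dcs S ts) (j + n) P aP) (length-dc t)
            (NodeArity-++⁻ʳ (dc S t) (dcs S ts) (subst (λ n → j + n ≤ P) (sym (length-dc t)) (ℕ.≮⇒≥ P≮t)) ar))
          1≤L L≤a (λ e∈ → above (∈-++⁺ʳ (termEdges t j p k a) e∈))))

  -- Decoding edge lists

  record IsRootEdge (ds : List Sym) (e : Edge) : Set where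
    constructor root
    field
      index≡1     : index e ≡ 1
      parent≡1    : parent e ≡ 1
      position≡0  : position e ≡ 0
      arityOfRoot : NodeArity ds 1 1 (parentArity e)

  IsEdgeOf : List Sym → Edge → Set
  IsEdgeOf ds e = IsRootEdge ds e ⊎ IsInnerEdge ds 1 e

  record Encodes (ds : List Sym) (E : List Edge) : Set where
    field
      length≡  : length E ≡ length ds
      numbered : NumberedFrom 1 E
      edgeOf   : ∀ {e} → e ∈ E → IsEdgeOf ds e
      nested   : Nested E

  edges-encodes : ∀ t → Encodes (dc S t) (edges t)
  edges-encodes t = record
    { length≡  = trans (length-termEdges t 1 1 0 (rootArity S t)) (sym (length-dc t))
    ; numbered = termEdges-numbered t 1 1 0 (rootArity S t)
    ; edgeOf   = edgeOf t
    ; nested   = termEdges-nested t 1 1 0 (rootArity S t)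
    }
    where
    edgeOf : ∀ t {e} → e ∈ edges t → IsEdgeOf (dc S t) e
    edgeOf (node s ts) e∈ with termEdge-cases (node s ts) e∈
    ... | inj₁ refl  = inj₁ (root refl refl refl (at 0 refl refl))
    ... | inj₂ e-inner = inj₂ e-inner

  Encodes-⊔ₑ : ∀ {ds xs ys} → Encodes ds xs → Encodes ds ys → Encodes ds (zipWith _⊔ₑ_ xs ys)
  Encodes-⊔ₑ {ds} {xs} {ys} enc-xs enc-ys = record
    { length≡  = trans (List.length-zipWith _⊔ₑ_ xs ys)
                   (trans (cong₂ ℕ._⊓_ (X.length≡) (Y.length≡)) (ℕ.⊓-idem (length ds)))
    ; numbered = NumberedFrom-⊔ₑ X.numbered Y.numbered
    ; edgeOf   = edgeOf
    ; nested   = Nested-⊔ₑ same X.nested Y.nested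
    }
    where
    module X = Encodes enc-xs
    module Y = Encodes enc-ys
    same : Pointwise SameIndex xs ys
    same = NumberedFrom-sameIndex (trans X.length≡ (sym Y.length≡)) X.numbered Y.numbered
    edgeOf : ∀ {e} → e ∈ zipWith _⊔ₑ_ xs ys → IsEdgeOf ds e
    edgeOf e∈ with ∈-zipWith⁻ same e∈
    ... | x , y , x∈ , y∈ , _ , refl with ⊔ₑ-sel x y
    ...   | inj₁ e≡x = subst (IsEdgeOf ds) (sym e≡x) (X.edgeOf x∈)
    ...   | inj₂ e≡y = subst (IsEdgeOf ds) (sym e≡y) (Y.edgeOf y∈)

  IsEdgeOf-parent≤index : ∀ {ds e} → IsEdgeOf ds e → parent e ≤ index e
  IsEdgeOf-parent≤index (inj₁ (root i≡1 p≡1 _ _))   = ℕ.≤-reflexive (trans p≡1 (sym i≡1))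
  IsEdgeOf-parent≤index (inj₂ (inner p<i _ _ _))    = ℕ.<⇒≤ p<i

  IsEdgeOf-++⁻ : ∀ ds {ys e} → parent e < 1 + length ds → IsEdgeOf (ds ++ ys) e → IsEdgeOf ds e
  IsEdgeOf-++⁻ ds {ys} p< (inj₁ (root i≡1 p≡1 pos≡0 ar)) =
    inj₁ (root i≡1 p≡1 pos≡0 (NodeArity-++⁻ˡ ds ys (subst (_< 1 + length ds) p≡1 p<) ar))
  IsEdgeOf-++⁻ ds {ys} p< (inj₂ (inner p<i 1≤pos pos≤ ar)) =
    inj₂ (inner p<i 1≤pos pos≤ (NodeArity-++⁻ˡ ds ys p< ar))

  Nested-++⁻ˡ : ∀ xs {ys} → Nested (xs ++ ys) → Nested xs
  Nested-++⁻ˡ xs nested e∈ e′∈ = nested (∈-++⁺ˡ e∈) (∈-++⁺ˡ e′∈)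

  Encodes-init : ∀ {ds s E e} → Encodes (ds ∷ʳ s) (E ∷ʳ e) → Encodes ds E
  Encodes-init {ds} {s} {E} {e} enc = record
    { length≡  = init-length≡
    ; numbered = proj₁ (NumberedFrom-++⁻ E numbered)
    ; edgeOf   = λ e′∈ → IsEdgeOf-++⁻ ds (parent< e′∈) (edgeOf (∈-++⁺ˡ e′∈))
    ; nested   = Nested-++⁻ˡ E nested
    }
    where
    open Encodes enc
    init-length≡ : length E ≡ length ds
    init-length≡ = ℕ.+-cancelʳ-≡ 1 (length E) (length ds)
      (trans (sym (List.length-++ E)) (trans (Encodes.length≡ enc) (List.length-++ ds)))
    parent< : ∀ {e′} → e′ ∈ E → parent e′ < 1 + length ds
    parent< {e′} e′∈ = ℕ.≤-<-trans (IsEdgeOf-parent≤index (edgeOf (∈-++⁺ˡ e′∈)))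
      (subst (λ n → index e′ < 1 + n) init-length≡ (proj₂ (NumberedFrom-∈ (proj₁ (NumberedFrom-++⁻ E numbered)) e′∈)))

  extend : ∀ t {sy e} → IsEdgeOf (dc S t ∷ʳ sy) e → index e ≡ suc (deg S t) →
           AboveAfter (parent e) (value e) (edges t) →
           Σ (Term S) λ t′ → dc S t′ ≡ dc S t ∷ʳ sy × edges t′ ≡ edges t ∷ʳ e
  extend leaf {sy} (inj₁ (root refl refl refl (at zero refl refl))) _ _ =
    node sy (Vec.replicate (arity sy) leaf) ,
    cong (sy ∷_) (dcs-leaves (replicate-leaves (arity sy))) ,
    cong (edge 1 1 0 (arity sy) ∷_) (forestEdges-leaves (replicate-leaves (arity sy)) 2 1 1 (arity sy))
  extend leaf (inj₂ (inner p<i _ _ ar)) refl _ = ⊥-elim (ℕ.<-irrefl refl (ℕ.<-≤-trans p<i (NodeArity-≥ ar)))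
  extend (node s ts) (inj₁ (root i≡1 _ _ _)) i≡ _ = ⊥-elim (ℕ.0≢1+n (ℕ.suc-injective (trans (sym i≡1) i≡)))
  extend (node s ts) {sy} {e} (inj₂ (inner p<i 1≤pos pos≤ ar)) i≡ above
    with insertTerm s ts 1 sy P< (NodeArity-++⁻ˡ (dc S (node s ts)) [ sy ] P<dc ar) 1≤pos pos≤
           (λ e′∈ P<e′ → subst (ℚ._< _) (value≡cncVal e) (above (there e′∈) P<e′))
    where
    P< : parent e < 1 + deg S (node s ts)
    P< = subst (parent e <_) i≡ p<i
    P<dc : parent e < 1 + length (dc S (node s ts))
    P<dc = subst (λ n → parent e < 1 + n) (sym (length-dc (node s ts))) P<
  ... | ts′ , dc≡ , edges≡ = node s ts′ , cong (s ∷_) dc≡ ,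
    cong (edge 1 1 0 (arity s) ∷_) (trans edges≡ (cong (λ i → _ ∷ʳ edge i (parent e) (position e) (parentArity e)) (sym i≡)))

  decode : ∀ {ds E} → Reverse E → Encodes ds E → Σ (Term S) λ t → dc S t ≡ ds × edges t ≡ E
  decode {[]}    [] _ = leaf , refl , refl
  decode {_ ∷ _} [] enc with () ← Encodes.length≡ enc
  decode {ds} (E ∶ rev ∶ʳ e) enc with reverseView ds
  ... | [] with () ← ℕ.m+1+n≢0 (length E) (trans (sym (List.length-++ E)) (Encodes.length≡ enc))
  ... | ds′ ∶ _ ∶ʳ s with decode rev (Encodes-init enc)
  ...   | t , refl , refl = extend t (edgeOf e∈) index≡ above
    where
    open Encodes enc
    e∈ : e ∈ edges t ∷ʳ e
    e∈ = ∈-++⁺ʳ (edges t) (here refl)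
    numbered-E : NumberedFrom 1 (edges t)
    numbered-E = proj₁ (NumberedFrom-++⁻ (edges t) numbered)
    index≡ : index e ≡ suc (deg S t)
    index≡ = trans (proj₁ (proj₂ (NumberedFrom-++⁻ (edges t) numbered))) (cong suc (length-termEdges t 1 1 0 _))
    above : AboveAfter (parent e) (value e) (edges t)
    above {e′} e′∈ pe< = nested e∈ (∈-++⁺ˡ e′∈) pe<
      (subst (index e′ <_) (sym index≡)
        (subst (λ n → index e′ < suc n) (length-termEdges t 1 1 0 _) (proj₂ (NumberedFrom-∈ numbered-E e′∈))))

  cnc-join : ∀ t₁ t₂ → dc S t₁ ≡ dc S t₂ →
             Σ (Term S) λ t₃ → dc S t₃ ≡ dc S t₁ × cnc S t₃ ≡ zipWith _⊔_ (cnc S t₁) (cnc S t₂)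
  cnc-join t₁ t₂ dc≡ with decode (reverseView _) (Encodes-⊔ₑ (edges-encodes t₁)
                            (subst (λ ds → Encodes ds (edges t₂)) (sym dc≡) (edges-encodes t₂)))
  ... | t₃ , dc-t₃ , edges-t₃ = t₃ , dc-t₃ , (begin
    cnc S t₃                                                   ≡⟨ cnc≡map-value-edges t₃ ⟩
    map value (edges t₃)                                       ≡⟨ cong (map value) edges-t₃ ⟩
    map value (zipWith _⊔ₑ_ (edges t₁) (edges t₂))             ≡⟨ map-value-⊔ₑ (edges t₁) (edges t₂) ⟩
    zipWith _⊔_ (map value (edges t₁)) (map value (edges t₂))
      ≡⟨ cong₂ (zipWith _⊔_) (cnc≡map-value-edges t₁) (cnc≡map-value-edges t₂) ⟨
    zipWith _⊔_ (cnc S t₁) (cnc S t₂)                          ∎)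
    where open ≡-Reasoning

proposition3p2p2 : {ℓ : Level} (S : Signature ℓ) (t t₁ t₂ : Term S) →
    _⪯_ S t t₁ → _⪯_ S t t₂ →
    Σ (Term S) λ t₃ →
      (dc S t₃ ≡ dc S t) × (cnc S t₃ ≡ zipWith _⊔_ (cnc S t₁) (cnc S t₂)) × _⪯_ S t t₃
proposition3p2p2 S t t₁ t₂ (dc≡₁ , cnc≤₁) (dc≡₂ , cnc≤₂)
  with cnc-join S t₁ t₂ (trans (sym dc≡₁) dc≡₂)
... | t₃ , dc-t₃ , cnc-t₃ = t₃ , dc≡ , cnc-t₃ , sym dc≡ ,
  subst (Pointwise ℚ._≤_ (cnc S t)) (sym cnc-t₃) (Pointwise-≤-⊔ cnc≤₁ cnc≤₂)
  where
  dc≡ : dc S t₃ ≡ dc S t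
  dc≡ = trans dc-t₃ (sym dc≡₁)
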